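{- If $A$ is a finite abelian group of odd order such that $d(A)=2$, where $d(A)$ is the minimum size of a generating set of $A$, then $\text{GEN}(\operatorname{Dih}(A))=*3$.
   Context: For a finite abelian group $A$, $\operatorname{Dih}(A)$ is the semidirect product $C_2\ltimes A$, where $C_2=\{1,x\}$ and $x$ acts on $A$ by inversion. For a finite group $G$, the game $\text{GEN}(G)$ is the impartial game whose positions are the subsets $P\subseteq G$ that either do not generate $G$ (nonterminal) or generate $G$ and contain some $g$ with $\langle P\setminus\{g\}\rangle\neq G$ (terminal). The start is $\emptyset$; the options of a nonterminal $P$ are $P\cup\{g\}$, $g\in G\setminus P$; terminal positions have no options. $\operatorname{nim}(P)=\operatorname{mex}\{\operatorname{nim}(Q): Q\text{ an option of }P\}$, and $\text{GEN}(G)=*n$ means $\operatorname{nim}(\emptyset)=n$. -}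

module Defs where

open import Level using (0ℓ)
open import Data.Nat using (ℕ; zero; suc; _<_)
open import Data.Nat.Divisibility using (_∣_)
open import Data.Fin using (Fin)
open import Data.Bool using (Bool; true; false; _xor_)
open import Data.Product using (_×_; _,_; Σ; ∃)
open import Data.Sum using (_⊎_)
open import Data.Empty using (⊥)
open import Data.Vec using (Vec)
open import Data.Vec.Membership.Propositional using () renaming (_∈_ to _∈ᵥ_)
open import Relation.Nullary using (¬_)
open import Relation.Binary.PropositionalEquality using (_≡_)
open import Algebra.Structures using (IsAbelianGroup)
open import Function.Bundles using (_↔_)

record GroupSig : Set₁ where
  field
    Carrier : Set
    _∙_     : Carrier → Carrier → Carrier
    ε       : Carrier
    _⁻¹     : Carrier → Carrier

Subset : Set → Set₁
Subset X = X → Set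

module _ (G : GroupSig) where
  open GroupSig G

  data ⟨_⟩ (P : Subset Carrier) : Carrier → Set where
    gen : ∀ {x} → P x → ⟨ P ⟩ x
    one : ⟨ P ⟩ ε
    mul : ∀ {x y} → ⟨ P ⟩ x → ⟨ P ⟩ y → ⟨ P ⟩ (x ∙ y)
    inv : ∀ {x} → ⟨ P ⟩ x → ⟨ P ⟩ (x ⁻¹)

  Generates : Subset Carrier → Set
  Generates P = ∀ g → ⟨ P ⟩ g

record FinAbGroup : Set₁ where
  field
    Carrier        : Set
    _∙_            : Carrier → Carrier → Carrier
    ε              : Carrier
    _⁻¹            : Carrier → Carrier
    isAbelianGroup : IsAbelianGroup _≡_ _∙_ ε _⁻¹
    order          : ℕ
    enum           : Carrier ↔ Fin order

  sig : GroupSig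
  sig = record { Carrier = Carrier ; _∙_ = _∙_ ; ε = ε ; _⁻¹ = _⁻¹ }

-- A has a generating set with at most k elements (a list of k elements,
-- repetitions allowed, whose underlying set generates A)
HasGenSetOfSize : FinAbGroup → ℕ → Set
HasGenSetOfSize A k =
  Σ (Vec (FinAbGroup.Carrier A) k) λ v → Generates (FinAbGroup.sig A) (λ g → g ∈ᵥ v)

d≡ : FinAbGroup → ℕ → Set
d≡ A n = HasGenSetOfSize A n × (∀ k → k < n → ¬ HasGenSetOfSize A k)

-- Dih(A) = C₂ ⋉ A, x acting by inversion.
-- An element (a , s) stands for a·xˢ (s = true meaning x), so
-- (a xˢ)(b xᵗ) = (a · xˢ b x⁻ˢ) x^(s+t) = (a · σˢ(b)) x^(s+t), σ = inversion.

module _ (A : FinAbGroup) where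
  open FinAbGroup A

  act : Bool → Carrier → Carrier
  act false b = b
  act true  b = b ⁻¹

  Dih : GroupSig
  Dih = record
    { Carrier = Carrier × Bool
    ; _∙_     = λ { (a , s) (b , t) → (a ∙ act s b , s xor t) }
    ; ε       = (ε , false)
    ; _⁻¹     = λ { (a , s) → (act s (a ⁻¹) , s) }
    }

-- A generating position (necessarily
-- terminal when reached in play) has no options; a non-generating P has
-- the options P ∪ {g}, g ∉ P.
-- NimValue G P n  means  nim(P) = n, defined inductively by the mex rule:
-- n is not the value of any option, and every m < n is the value of some
-- option.  (Nim-values are unique, so this is the graph of nim.)

module _ (G : GroupSig) where
  open GroupSig G

  ∅ : Subset Carrier
  ∅ _ = ⊥

  _∪｛_｝ : Subset Carrier → Carrier → Subset Carrier
  (P ∪｛ g ｝) x = P x ⊎ x ≡ g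

  data NimValue : Subset Carrier → ℕ → Set₁ where
    terminal : ∀ {P} → Generates G P → NimValue P 0
    mex      : ∀ {P n} → ¬ Generates G P
             → (∀ g → ¬ P g → ∃ λ m → NimValue (P ∪｛ g ｝) m × ¬ m ≡ n)
             → (∀ m → m < n → ∃ λ g → ¬ P g × NimValue (P ∪｛ g ｝) m)
             → NimValue P n

  GEN≡* : ℕ → Set₁
  GEN≡* n = NimValue ∅ n

Odd : ℕ → Set
Odd n = ¬ (2 ∣ n)

-- As far as its nim-value goes, a position P of GEN(Dih A) is described by four
-- facts: whether P contains a reflection, whether ⟨P⟩ contains every rotation,
-- whether it does after adjoining one more rotation ("nearly rotational"), and
-- the parity of |P|; the value is read off a table in these facts.  No option
-- of P has the value of P, because a move can change the facts only in
-- constrained ways (for instance, a first reflection adds no rotation), and a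
-- finite check of the table against these constraints suffices.  Every smaller
-- value is realised by adjoining a rotation completing the rotations, a
-- generator of A, the reflection x, or an element of ⟨P⟩ outside P.  Such an
-- element exists by parity: if ⟨P⟩ = P, multiplication by a reflection of P is
-- a fixed-point-free involution of P, and if P has no reflection, inversion is
-- an involution of P fixing only 1, as |A| is odd.  Since d(A) = 2, A is not
-- cyclic, so the empty position is not nearly rotational and has value 3.

module Submission where

open import Defs

open import Algebra.Bundles using (AbelianGroup)
import Algebra.Properties.AbelianGroup as AbelianGroupProperties
import Algebra.Properties.CommutativeSemigroup as CommutativeSemigroupProperties
open import Data.Bool using (Bool; true; false; not; _∧_; _∨_; if_then_else_; T)
import Data.Bool.Properties as Bool
open import Data.Bool.Properties using (not-involutive; T-∧; T-≡)
open import Data.Empty using (⊥; ⊥-elim)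
import Data.Fin.Properties as Fin
open import Data.List as List using (List; []; _∷_; length; allFin; cartesianProduct)
open import Data.List.Membership.Propositional using () renaming (_∈_ to _∈ˢ_)
open import Data.List.Membership.Propositional.Properties using (∈-map⁺; ∈-allFin; ∈-cartesianProduct⁺)
open import Data.List.Properties using (length-map; length-tabulate)
open import Data.List.Relation.Unary.All as All using ()
open import Data.List.Relation.Unary.AllPairs using ([]; _∷_)
open import Data.List.Relation.Unary.Any using (here; there)
open import Data.List.Relation.Unary.Unique.Propositional using () renaming (Unique to Uniqueˢ)
import Data.List.Relation.Unary.Unique.Propositional.Properties as Uniqueˢ
open import Data.Nat using (ℕ; zero; suc; _<_; _≤_; z≤n; s≤s; _≡ᵇ_)
open import Data.Nat.Divisibility using (_∣_; divides)
open import Data.Nat.Induction using (<-wellFounded)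
open import Data.Nat.Properties using (m≤n⇒m≤1+n; suc-injective; ≡⇒≡ᵇ)
open import Data.Product using (∃; _×_; _,_; proj₁; proj₂)
open import Data.Product.Properties using (≡-dec)
open import Data.Sum using (_⊎_; inj₁; inj₂)
open import Data.Unit using (⊤; tt)
open import Data.Vec using (Vec; []; _∷_)
open import Data.Vec.Membership.Propositional using () renaming (_∈_ to _∈ᵥ_)
open import Data.Vec.Relation.Unary.Any using (here; there)
open import Function using (_on_; id)
open import Function.Bundles using (Inverse; Equivalence)
open import Function.Properties.Inverse using (↔⇒↣)
open import Induction.WellFounded using (WellFounded; Acc; acc)
open import Level using (0ℓ)
open import Relation.Binary.Construct.On as On using ()
open import Relation.Binary.Definitions using (DecidableEquality)
open import Relation.Binary.PropositionalEquality
  using (_≡_; _≢_; refl; sym; trans; cong; subst; module ≡-Reasoning)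
open import Relation.Nullary using (¬_; Dec; yes; no; does; proof; ¬?)
open import Relation.Nullary.Decidable
  using (via-injection; map′; decidable-stable; dec-true; _⊎-dec_; _×-dec_; _→-dec_)
open import Relation.Nullary.Reflects using (Reflects; ofʸ; ofⁿ; det)

even : ℕ → Bool
even zero    = true
even (suc n) = not (even n)

even⇒2∣ : ∀ n → even n ≡ true → 2 ∣ n
even⇒2∣ zero          _ = divides 0 refl
even⇒2∣ (suc (suc n)) e with even⇒2∣ n (trans (sym (not-involutive (even n))) e)
... | divides q n≡q*2 = divides (suc q) (cong (λ m → suc (suc m)) n≡q*2)

Reflects-map : ∀ {A B : Set} {b} → (A → B) → (B → A) → Reflects A b → Reflects B b
Reflects-map A→B B→A (ofʸ a)  = ofʸ (A→B a)
Reflects-map A→B B→A (ofⁿ ¬a) = ofⁿ (λ b → ¬a (B→A b))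

module _ {X : Set} where

  infix 4 _∈_ _∉_

  -- Chosen to agree definitionally with the game's subsets ∅ and P ∪｛ g ｝.
  _∈_ : X → List X → Set
  x ∈ []     = ⊥
  x ∈ y ∷ ys = x ∈ ys ⊎ x ≡ y

  _∉_ : X → List X → Set
  x ∉ xs = ¬ x ∈ xs

  Unique : List X → Set
  Unique []       = ⊤
  Unique (x ∷ xs) = x ∉ xs × Unique xs

  ∈ˢ⇒∈ : ∀ {x xs} → x ∈ˢ xs → x ∈ xs
  ∈ˢ⇒∈ (here refl) = inj₂ refl
  ∈ˢ⇒∈ (there x∈)  = inj₁ (∈ˢ⇒∈ x∈)

  ∈⇒∈ˢ : ∀ {x} xs → x ∈ xs → x ∈ˢ xs
  ∈⇒∈ˢ (_ ∷ xs) (inj₁ x∈)  = there (∈⇒∈ˢ xs x∈)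
  ∈⇒∈ˢ (_ ∷ _)  (inj₂ refl) = here refl

  Uniqueˢ⇒Unique : ∀ {xs} → Uniqueˢ xs → Unique xs
  Uniqueˢ⇒Unique []                 = tt
  Uniqueˢ⇒Unique (x≢xs ∷ xs-unique) = (λ x∈ → All.lookup x≢xs (∈⇒∈ˢ _ x∈) refl) , Uniqueˢ⇒Unique xs-unique

  module DecidableMembership (_≟_ : DecidableEquality X) where

    _∈?_ : ∀ x xs → Dec (x ∈ xs)
    x ∈? []       = no λ ()
    x ∈? (y ∷ ys) = (x ∈? ys) ⊎-dec (x ≟ y)

    remove : X → List X → List X
    remove z []       = []
    remove z (y ∷ ys) with z ≟ y
    ... | yes _ = ys
    ... | no  _ = y ∷ remove z ys

    length-remove : ∀ {z} xs → z ∈ xs → suc (length (remove z xs)) ≡ length xs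
    length-remove {z} (y ∷ ys) z∈ with z ≟ y | z∈
    ... | yes _   | _        = refl
    ... | no  _   | inj₁ z∈ys = cong suc (length-remove ys z∈ys)
    ... | no  z≢y | inj₂ z≡y = ⊥-elim (z≢y z≡y)

    ∈-remove⁻ : ∀ {z x} xs → x ∈ remove z xs → x ∈ xs
    ∈-remove⁻ {z} (y ∷ ys) x∈ with z ≟ y | x∈
    ... | yes _ | x∈ys     = inj₁ x∈ys
    ... | no  _ | inj₁ x∈r = inj₁ (∈-remove⁻ ys x∈r)
    ... | no  _ | inj₂ x≡y = inj₂ x≡y

    ∈-remove⁺ : ∀ {z x} xs → x ∈ xs → x ≢ z → x ∈ remove z xs
    ∈-remove⁺ {z} (y ∷ ys) x∈ x≢z with z ≟ y | x∈
    ... | yes _   | inj₁ x∈ys = x∈ys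
    ... | yes z≡y | inj₂ x≡y  = ⊥-elim (x≢z (trans x≡y (sym z≡y)))
    ... | no  _   | inj₁ x∈ys = inj₁ (∈-remove⁺ ys x∈ys x≢z)
    ... | no  _   | inj₂ x≡y  = inj₂ x≡y

    ∈-remove-≢ : ∀ {z x} xs → Unique xs → x ∈ remove z xs → x ≢ z
    ∈-remove-≢ {z} (y ∷ ys) (y∉ys , ys-unique) x∈ with z ≟ y | x∈
    ... | yes refl | x∈ys     = λ { refl → y∉ys x∈ys }
    ... | no  _    | inj₁ x∈r = ∈-remove-≢ ys ys-unique x∈r
    ... | no  z≢y  | inj₂ x≡y = λ x≡z → z≢y (trans (sym x≡z) x≡y)

    remove-unique : ∀ {z} xs → Unique xs → Unique (remove z xs)
    remove-unique         []       _                  = tt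
    remove-unique {z} (y ∷ ys) (y∉ys , ys-unique) with z ≟ y
    ... | yes _ = ys-unique
    ... | no  _ = (λ y∈r → y∉ys (∈-remove⁻ ys y∈r)) , remove-unique ys ys-unique

    module _ (ι : X → X) (ι-involutive : ∀ x → ι (ι x) ≡ x) where

      ι-Closed : List X → Set
      ι-Closed xs = ∀ {x} → x ∈ xs → ι x ∈ xs

      ι-injective : ∀ {x y} → ι x ≡ ι y → x ≡ y
      ι-injective {x} {y} ιx≡ιy = trans (sym (ι-involutive x)) (trans (cong ι ιx≡ιy) (ι-involutive y))

      even-length-if-fixedPointFree : ∀ xs → Unique xs → ι-Closed xs →
                                      (∀ {x} → x ∈ xs → ι x ≢ x) → even (length xs) ≡ true
      even-length-if-fixedPointFree xs = go (length xs) xs refl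
        where
        go : ∀ n xs → length xs ≡ n → Unique xs → ι-Closed xs →
             (∀ {x} → x ∈ xs → ι x ≢ x) → even n ≡ true
        go zero          []           _   _ _ _ = refl
        go (suc zero)    (x ∷ [])     _   _ closed free with closed (inj₂ refl)
        ... | inj₂ ιx≡x = ⊥-elim (free (inj₂ refl) ιx≡x)
        go (suc (suc n)) (x ∷ xs) len (x∉xs , xs-unique) closed free =
          trans (not-involutive (even n))
                (go n rest len-rest (remove-unique xs xs-unique) rest-closed (λ y∈ → free (inj₁ (∈-remove⁻ xs y∈))))
          where
          ιx∈xs : ι x ∈ xs
          ιx∈xs with closed (inj₂ refl)
          ... | inj₁ ιx∈ = ιx∈
          ... | inj₂ ιx≡x = ⊥-elim (free (inj₂ refl) ιx≡x)
          rest : List X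
          rest = remove (ι x) xs
          len-rest : length rest ≡ n
          len-rest = suc-injective (trans (length-remove xs ιx∈xs) (suc-injective len))
          rest-closed : ι-Closed rest
          rest-closed {y} y∈ = ∈-remove⁺ xs ιy∈xs (λ ιy≡ιx → x∉xs (subst (_∈ xs) (ι-injective ιy≡ιx) y∈xs))
            where
            y∈xs : y ∈ xs
            y∈xs = ∈-remove⁻ xs y∈
            ιy∈xs : ι y ∈ xs
            ιy∈xs with closed (inj₁ y∈xs)
            ... | inj₁ ιy∈ = ιy∈
            ... | inj₂ ιy≡x = ⊥-elim (∈-remove-≢ xs xs-unique y∈ (trans (sym (ι-involutive y)) (cong ι ιy≡x)))
        go zero          (_ ∷ _)      ()
        go (suc _)       []           ()
        go (suc zero)    (_ ∷ _ ∷ _)  ()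

      odd-length-if-uniqueFixedPoint : ∀ {e} xs → Unique xs → ι-Closed xs → e ∈ xs → ι e ≡ e →
                                       (∀ {x} → x ∈ xs → ι x ≡ x → x ≡ e) → even (length xs) ≡ false
      odd-length-if-uniqueFixedPoint {e} xs xs-unique closed e∈xs ιe≡e fixed⇒e =
        trans (cong even (sym (length-remove xs e∈xs)))
              (cong not (even-length-if-fixedPointFree rest (remove-unique xs xs-unique) rest-closed rest-free))
        where
        rest : List X
        rest = remove e xs
        rest-closed : ι-Closed rest
        rest-closed {y} y∈ = ∈-remove⁺ xs (closed (∈-remove⁻ xs y∈))
          (λ ιy≡e → ∈-remove-≢ xs xs-unique y∈ (trans (sym (ι-involutive y)) (trans (cong ι ιy≡e) ιe≡e)))
        rest-free : ∀ {x} → x ∈ rest → ι x ≢ x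
        rest-free x∈ ιx≡x = ∈-remove-≢ xs xs-unique x∈ (fixed⇒e (∈-remove⁻ xs x∈) ιx≡x)

module Enumerated {X : Set} (_≟_ : DecidableEquality X)
                  (elements : List X) (complete : ∀ x → x ∈ elements) where

  open DecidableMembership _≟_

  ∃? : {Q : X → Set} → (∀ x → Dec (Q x)) → Dec (∃ Q)
  ∃? {Q} Q? = map′ (λ (x , _ , q) → x , q) (λ (x , q) → x , complete x , q) (search elements)
    where
    search : ∀ xs → Dec (∃ λ x → x ∈ xs × Q x)
    search []       = no λ ()
    search (y ∷ ys) = map′ (λ { (inj₁ (x , x∈ , q)) → x , inj₁ x∈ , q ; (inj₂ q) → y , inj₂ refl , q })
                           (λ { (x , inj₁ x∈ , q) → inj₁ (x , x∈ , q) ; (x , inj₂ refl , q) → inj₂ q })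
                           (search ys ⊎-dec Q? y)

  ∀? : {Q : X → Set} → (∀ x → Dec (Q x)) → Dec (∀ x → Q x)
  ∀? Q? = map′ (λ ∄¬Q x → decidable-stable (Q? x) (λ ¬q → ∄¬Q (x , ¬q)))
               (λ ∀Q (x , ¬q) → ¬q (∀Q x))
               (¬? (∃? (λ x → ¬? (Q? x))))

  missingFrom : List X → List X → ℕ
  missingFrom []       S = 0
  missingFrom (x ∷ xs) S = if does (x ∈? S) then missingFrom xs S else suc (missingFrom xs S)

  missingFrom-∷-≤ : ∀ xs {S y} → missingFrom xs (y ∷ S) ≤ missingFrom xs S
  missingFrom-∷-≤ []                   = z≤n
  missingFrom-∷-≤ (x ∷ xs) {S} {y} with x ∈? S | x ≟ y
  ... | yes _ | _     = missingFrom-∷-≤ xs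
  ... | no  _ | yes _ = m≤n⇒m≤1+n (missingFrom-∷-≤ xs)
  ... | no  _ | no  _ = s≤s (missingFrom-∷-≤ xs)

  missingFrom-∷-< : ∀ xs {S y} → y ∈ xs → y ∉ S → missingFrom xs (y ∷ S) < missingFrom xs S
  missingFrom-∷-< (x ∷ xs) {S} {y} y∈ y∉S with x ∈? S | x ≟ y | y∈
  ... | yes _   | _     | inj₁ y∈xs = missingFrom-∷-< xs y∈xs y∉S
  ... | yes x∈S | _     | inj₂ refl = ⊥-elim (y∉S x∈S)
  ... | no  _   | yes _ | _         = s≤s (missingFrom-∷-≤ xs)
  ... | no  _   | no  _ | inj₁ y∈xs = s≤s (missingFrom-∷-< xs y∈xs y∉S)
  ... | no  _   | no x≢y | inj₂ y≡x = ⊥-elim (x≢y (sym y≡x))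

  missing : List X → ℕ
  missing = missingFrom elements

  missing-∷ : ∀ {S x} → x ∉ S → missing (x ∷ S) < missing S
  missing-∷ {x = x} = missingFrom-∷-< elements (complete x)

  _⊏_ : List X → List X → Set
  _⊏_ = _<_ on missing

  ⊏-wellFounded : WellFounded _⊏_
  ⊏-wellFounded = On.wellFounded missing <-wellFounded

module _ (G : GroupSig) where
  open GroupSig G

  record IsSubgroup (Q : Subset Carrier) : Set where
    field
      ε∈  : Q ε
      ∙∈  : ∀ {x y} → Q x → Q y → Q (x ∙ y)
      ⁻¹∈ : ∀ {x} → Q x → Q (x ⁻¹)

  ⟨⟩-least : ∀ {P Q} → IsSubgroup Q → (∀ {x} → P x → Q x) → ∀ {x} → ⟨_⟩ G P x → Q x
  ⟨⟩-least Q-sub P⊆Q (gen p)   = P⊆Q p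
  ⟨⟩-least Q-sub P⊆Q one       = IsSubgroup.ε∈ Q-sub
  ⟨⟩-least Q-sub P⊆Q (mul p q) = IsSubgroup.∙∈ Q-sub (⟨⟩-least Q-sub P⊆Q p) (⟨⟩-least Q-sub P⊆Q q)
  ⟨⟩-least Q-sub P⊆Q (inv p)   = IsSubgroup.⁻¹∈ Q-sub (⟨⟩-least Q-sub P⊆Q p)

  ⟨⟩-isSubgroup : ∀ P → IsSubgroup (⟨_⟩ G P)
  ⟨⟩-isSubgroup P = record { ε∈ = one ; ∙∈ = mul ; ⁻¹∈ = inv }

  ⟨⟩-⊆ : ∀ {P Q} → (∀ {x} → P x → ⟨_⟩ G Q x) → ∀ {x} → ⟨_⟩ G P x → ⟨_⟩ G Q x
  ⟨⟩-⊆ {Q = Q} = ⟨⟩-least (⟨⟩-isSubgroup Q)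

module GeneratedSubgroup (G : GroupSig) (_≟_ : DecidableEquality (GroupSig.Carrier G))
                         (elements : List (GroupSig.Carrier G))
                         (complete : ∀ x → x ∈ elements) where

  open GroupSig G
  open DecidableMembership _≟_
  open Enumerated _≟_ elements complete

  infix 4 _∈⟨_⟩

  _∈⟨_⟩ : Carrier → List Carrier → Set
  x ∈⟨ P ⟩ = ⟨_⟩ G (_∈ P) x

  OneStep : List Carrier → Carrier → Set
  OneStep S x = (∃ λ a → ∃ λ b → a ∈ S × b ∈ S × x ≡ a ∙ b) ⊎ (∃ λ a → a ∈ S × x ≡ a ⁻¹)

  oneStep? : ∀ S x → Dec (OneStep S x)
  oneStep? S x = ∃? (λ a → ∃? λ b → (a ∈? S) ×-dec (b ∈? S) ×-dec (x ≟ (a ∙ b)))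
          ⊎-dec ∃? (λ a → (a ∈? S) ×-dec (x ≟ (a ⁻¹)))

  oneStep-⊆ : ∀ {S P x} → (∀ {y} → y ∈ S → y ∈⟨ P ⟩) → OneStep S x → x ∈⟨ P ⟩
  oneStep-⊆ S⊆⟨P⟩ (inj₁ (a , b , a∈S , b∈S , refl)) = mul (S⊆⟨P⟩ a∈S) (S⊆⟨P⟩ b∈S)
  oneStep-⊆ S⊆⟨P⟩ (inj₂ (a , a∈S , refl))           = inv (S⊆⟨P⟩ a∈S)

  module _ (P : List Carrier) where

    record Saturation : Set where
      field
        S          : List Carrier
        S⊆⟨P⟩      : ∀ {x} → x ∈ S → x ∈⟨ P ⟩
        P⊆S        : ∀ {x} → x ∈ P → x ∈ S
        isSubgroup : IsSubgroup G (_∈ S)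

    saturate : ∀ S → Acc _⊏_ S → (∀ {x} → x ∈ S → x ∈⟨ P ⟩) → (∀ {x} → x ∈ P → x ∈ S) → ε ∈ S → Saturation
    saturate S (acc rec) S⊆⟨P⟩ P⊆S ε∈S with ∃? (λ x → ¬? (x ∈? S) ×-dec oneStep? S x)
    ... | yes (x , x∉S , step) = saturate (x ∷ S) (rec (missing-∷ x∉S)) extended (λ p → inj₁ (P⊆S p)) (inj₁ ε∈S)
      where
      extended : ∀ {y} → y ∈ x ∷ S → y ∈⟨ P ⟩
      extended (inj₁ y∈S)  = S⊆⟨P⟩ y∈S
      extended (inj₂ refl) = oneStep-⊆ S⊆⟨P⟩ step
    ... | no stuck = record
      { S = S ; S⊆⟨P⟩ = S⊆⟨P⟩ ; P⊆S = P⊆S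
      ; isSubgroup = record
        { ε∈  = ε∈S
        ; ∙∈  = λ a∈S b∈S → closed (inj₁ (_ , _ , a∈S , b∈S , refl))
        ; ⁻¹∈ = λ a∈S → closed (inj₂ (_ , a∈S , refl))
        }
      }
      where
      closed : ∀ {x} → OneStep S x → x ∈ S
      closed {x} step = decidable-stable (x ∈? S) (λ x∉S → stuck (x , x∉S , step))

  infix 4 _∈⟨_⟩?

  _∈⟨_⟩? : ∀ x P → Dec (x ∈⟨ P ⟩)
  x ∈⟨ P ⟩? = map′ S⊆⟨P⟩ (⟨⟩-least G isSubgroup P⊆S) (x ∈? S)
    where
    start : ∀ {x} → x ∈ ε ∷ P → x ∈⟨ P ⟩
    start (inj₁ x∈P)  = gen x∈P
    start (inj₂ refl) = one
    open Saturation (saturate P (ε ∷ P) (⊏-wellFounded _) start inj₁ (inj₂ refl))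

  ∈⟨⟩-mono : ∀ {P Q x} → (∀ {y} → y ∈ P → y ∈ Q) → x ∈⟨ P ⟩ → x ∈⟨ Q ⟩
  ∈⟨⟩-mono P⊆Q = ⟨⟩-⊆ G (λ y∈P → gen (P⊆Q y∈P))

  ∈⟨⟩-∷⁺ : ∀ {P g x} → x ∈⟨ P ⟩ → x ∈⟨ g ∷ P ⟩
  ∈⟨⟩-∷⁺ = ∈⟨⟩-mono inj₁

  ∈⟨⟩-∷⁻ : ∀ {P h x} → h ∈⟨ P ⟩ → x ∈⟨ h ∷ P ⟩ → x ∈⟨ P ⟩
  ∈⟨⟩-∷⁻ h∈⟨P⟩ = ⟨⟩-⊆ G λ { (inj₁ y∈P) → gen y∈P ; (inj₂ refl) → h∈⟨P⟩ }

  ∈⟨⟩-swap : ∀ {P g h x} → x ∈⟨ g ∷ h ∷ P ⟩ → x ∈⟨ h ∷ g ∷ P ⟩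
  ∈⟨⟩-swap = ∈⟨⟩-mono λ { (inj₁ (inj₁ y∈P)) → inj₁ (inj₁ y∈P) ; (inj₁ (inj₂ y≡h)) → inj₂ y≡h
                        ; (inj₂ y≡g) → inj₁ (inj₂ y≡g) }

  NewElement : List Carrier → Set
  NewElement P = ∃ λ h → h ∈⟨ P ⟩ × h ∉ P

  newElement? : ∀ P → Dec (NewElement P)
  newElement? P = ∃? (λ h → (h ∈⟨ P ⟩?) ×-dec ¬? (h ∈? P))

  ¬newElement⇒closed : ∀ {P x} → ¬ NewElement P → x ∈⟨ P ⟩ → x ∈ P
  ¬newElement⇒closed {P} {x} ¬new x∈⟨P⟩ = decidable-stable (x ∈? P) (λ x∉P → ¬new (x , x∈⟨P⟩ , x∉P))

module FiniteAbelianGroup (A : FinAbGroup) where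

  open FinAbGroup A public renaming (_∙_ to infixl 7 _∙_; _⁻¹ to infix 8 _⁻¹)
  open Inverse enum using (to; from; strictlyInverseˡ; strictlyInverseʳ)

  abelianGroup : AbelianGroup 0ℓ 0ℓ
  abelianGroup = record { isAbelianGroup = isAbelianGroup }

  open AbelianGroup abelianGroup public using (assoc; identityʳ; inverseʳ)
  open AbelianGroupProperties abelianGroup public
    using (⁻¹-∙-comm; ⁻¹-involutive; ε⁻¹≈ε; identityʳ-unique; //-rightDividesˡ; //-rightDividesʳ)

  _≟_ : DecidableEquality Carrier
  _≟_ = via-injection (↔⇒↣ enum) Fin._≟_

  elements : List Carrier
  elements = List.map from (allFin order)

  elements-complete : ∀ a → a ∈ elements
  elements-complete a = subst (_∈ elements) (strictlyInverseʳ a) (∈ˢ⇒∈ (∈-map⁺ from (∈-allFin (to a))))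

  elements-unique : Unique elements
  elements-unique = Uniqueˢ⇒Unique (Uniqueˢ.map⁺ from-injective (Uniqueˢ.allFin⁺ order))
    where
    from-injective : ∀ {i j} → from i ≡ from j → i ≡ j
    from-injective {i} {j} eq = trans (sym (strictlyInverseˡ i)) (trans (cong to eq) (strictlyInverseˡ j))

  length-elements : length elements ≡ order
  length-elements = trans (length-map from (allFin order)) (length-tabulate id)

  odd-order⇒x∙x≡ε⇒x≡ε : Odd order → ∀ a → a ∙ a ≡ ε → a ≡ ε
  odd-order⇒x∙x≡ε⇒x≡ε odd a a∙a≡ε with a ≟ ε
  ... | yes a≡ε = a≡ε
  ... | no  a≢ε = ⊥-elim (odd (subst (2 ∣_) length-elements (even⇒2∣ _ elements-even)))
    where
    open DecidableMembership _≟_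
    ∙a-involutive : ∀ x → (x ∙ a) ∙ a ≡ x
    ∙a-involutive x = trans (assoc x a a) (trans (cong (x ∙_) a∙a≡ε) (identityʳ x))
    elements-even : even (length elements) ≡ true
    elements-even = even-length-if-fixedPointFree (_∙ a) ∙a-involutive elements elements-unique
      (λ {x} _ → elements-complete (x ∙ a))
      (λ {x} _ x∙a≡x → a≢ε (identityʳ-unique x a x∙a≡x))

module Dihedral (A : FinAbGroup) where

  open FiniteAbelianGroup A
  open CommutativeSemigroupProperties (AbelianGroup.commutativeSemigroup abelianGroup)
    using (xy∙z≈xz∙y; interchange)
  open ≡-Reasoning

  D : GroupSig
  D = Dih A

  open GroupSig D using () renaming (_∙_ to infixl 7 _·_; _⁻¹ to infix 8 _⁻¹ᴰ)

  rot ref : Carrier → Carrier × Bool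
  rot a = a , false
  ref a = a , true

  _≟ᴰ_ : DecidableEquality (Carrier × Bool)
  _≟ᴰ_ = ≡-dec _≟_ Bool._≟_

  elementsᴰ : List (Carrier × Bool)
  elementsᴰ = cartesianProduct elements (false ∷ true ∷ [])

  elementsᴰ-complete : ∀ x → x ∈ elementsᴰ
  elementsᴰ-complete (a , s) = ∈ˢ⇒∈ (∈-cartesianProduct⁺ (∈⇒∈ˢ elements (elements-complete a)) (bool∈ s))
    where
    bool∈ : ∀ s → s ∈ˢ false ∷ true ∷ []
    bool∈ false = here refl
    bool∈ true  = there (here refl)

  open DecidableMembership _≟ᴰ_ public
  open Enumerated _≟_ elements elements-complete using () renaming (∃? to ∃?ᴬ; ∀? to ∀?ᴬ)
  open GeneratedSubgroup D _≟ᴰ_ elementsᴰ elementsᴰ-complete public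

  rot-subst : ∀ {P a b} → a ≡ b → rot a ∈⟨ P ⟩ → rot b ∈⟨ P ⟩
  rot-subst {P} = subst (λ a → rot a ∈⟨ P ⟩)

  rot-⟨⟩ : ∀ {Q P a} → (∀ {c} → Q c → rot c ∈⟨ P ⟩) → ⟨_⟩ sig Q a → rot a ∈⟨ P ⟩
  rot-⟨⟩ Q⊆ = ⟨⟩-least sig (record { ε∈ = one ; ∙∈ = mul ; ⁻¹∈ = inv }) Q⊆

  Reflective : List (Carrier × Bool) → Set
  Reflective P = ∃ λ b → ref b ∈ P

  Rotational : List (Carrier × Bool) → Set
  Rotational P = ∀ a → rot a ∈⟨ P ⟩

  NearlyRotational : List (Carrier × Bool) → Set
  NearlyRotational P = ∃ λ c → Rotational (rot c ∷ P)

  opaque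
    reflective? : ∀ P → Dec (Reflective P)
    reflective? P = ∃?ᴬ (λ b → ref b ∈? P)

    rotational? : ∀ P → Dec (Rotational P)
    rotational? P = ∀?ᴬ (λ a → rot a ∈⟨ P ⟩?)

    nearlyRotational? : ∀ P → Dec (NearlyRotational P)
    nearlyRotational? P = ∃?ᴬ (λ c → rotational? (rot c ∷ P))

  generates : ∀ {P} → Reflective P → Rotational P → Generates D (_∈ P)
  generates     (b , ref-b∈P) rotational (a , false) = rotational a
  generates {P} (b , ref-b∈P) rotational (a , true)  =
    subst (λ a → ref a ∈⟨ P ⟩) (//-rightDividesˡ b a) (mul (rotational (a ∙ b ⁻¹)) (gen ref-b∈P))

  ¬reflective-⟨⟩ : ∀ {P x} → ¬ Reflective P → x ∈⟨ P ⟩ →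
                   proj₂ x ≡ false × ⟨_⟩ sig (λ c → rot c ∈ P) (proj₁ x)
  ¬reflective-⟨⟩ {P} ¬refl = ⟨⟩-least D rotations base
    where
    rotations : IsSubgroup D (λ x → proj₂ x ≡ false × ⟨_⟩ sig (λ c → rot c ∈ P) (proj₁ x))
    rotations = record
      { ε∈  = refl , one
      ; ∙∈  = λ { (refl , p) (refl , q) → refl , mul p q }
      ; ⁻¹∈ = λ { (refl , p) → refl , inv p }
      }
    base : ∀ {x} → x ∈ P → proj₂ x ≡ false × ⟨_⟩ sig (λ c → rot c ∈ P) (proj₁ x)
    base {a , false} x∈P = refl , gen x∈P
    base {a , true}  x∈P = ⊥-elim (¬refl (a , x∈P))

  generates⇒reflective : ∀ {P} → Generates D (_∈ P) → Reflective P
  generates⇒reflective {P} generates-P with reflective? P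
  ... | yes refl-P = refl-P
  ... | no ¬refl-P with ¬reflective-⟨⟩ ¬refl-P (generates-P (ref ε))
  ... | () , _

  -- Every element (a , true) of ⟨ ref c ∷ P ⟩ is rot (a ∙ c ⁻¹) · ref c.
  rot∈⟨ref∷⟩ : ∀ {P c a} → ¬ Reflective P → rot a ∈⟨ ref c ∷ P ⟩ → rot a ∈⟨ P ⟩
  rot∈⟨ref∷⟩ {P} {c} ¬refl = ⟨⟩-least D (record { ε∈ = one ; ∙∈ = λ {x} {y} → ∙∈ {x} {y} ; ⁻¹∈ = λ {x} → ⁻¹∈ {x} }) base
    where
    Q : Carrier × Bool → Set
    Q (a , false) = rot a ∈⟨ P ⟩
    Q (a , true)  = rot (a ∙ c ⁻¹) ∈⟨ P ⟩

    c⁻¹-cancel : ∀ a b → (a ∙ c ⁻¹) ∙ (b ∙ c ⁻¹) ⁻¹ ≡ a ∙ b ⁻¹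
    c⁻¹-cancel a b = begin
      (a ∙ c ⁻¹) ∙ (b ∙ c ⁻¹) ⁻¹          ≡⟨ cong ((a ∙ c ⁻¹) ∙_) (sym (⁻¹-∙-comm b (c ⁻¹))) ⟩
      (a ∙ c ⁻¹) ∙ (b ⁻¹ ∙ (c ⁻¹) ⁻¹)     ≡⟨ interchange a (c ⁻¹) (b ⁻¹) ((c ⁻¹) ⁻¹) ⟩
      (a ∙ b ⁻¹) ∙ (c ⁻¹ ∙ (c ⁻¹) ⁻¹)     ≡⟨ cong ((a ∙ b ⁻¹) ∙_) (inverseʳ (c ⁻¹)) ⟩
      (a ∙ b ⁻¹) ∙ ε                      ≡⟨ identityʳ (a ∙ b ⁻¹) ⟩
      a ∙ b ⁻¹                            ∎

    ∙∈ : ∀ {x y} → Q x → Q y → Q (x · y)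
    ∙∈ {a , false} {b , false} p q = mul p q
    ∙∈ {a , false} {b , true}  p q = rot-subst (sym (assoc a b (c ⁻¹))) (mul p q)
    ∙∈ {a , true}  {b , false} p q = rot-subst (xy∙z≈xz∙y a (c ⁻¹) (b ⁻¹)) (mul p (inv q))
    ∙∈ {a , true}  {b , true}  p q = rot-subst (c⁻¹-cancel a b) (mul p (inv q))

    ⁻¹∈ : ∀ {x} → Q x → Q (x ⁻¹ᴰ)
    ⁻¹∈ {a , false} p = inv p
    ⁻¹∈ {a , true}  p = rot-subst (cong (_∙ c ⁻¹) (sym (⁻¹-involutive a))) p

    base : ∀ {x} → x ∈ ref c ∷ P → Q x
    base {a , false} (inj₁ x∈P)  = gen x∈P
    base {a , true}  (inj₁ x∈P)  = ⊥-elim (¬refl (a , x∈P))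
    base {a , true}  (inj₂ refl) = rot-subst (sym (inverseʳ c)) one

  reflective-∷ : ∀ {P g} → Reflective P → Reflective (g ∷ P)
  reflective-∷ (b , ref-b∈P) = b , inj₁ ref-b∈P

  rotational-∷ : ∀ {P g} → Rotational P → Rotational (g ∷ P)
  rotational-∷ rotational-P a = ∈⟨⟩-∷⁺ (rotational-P a)

  nearlyRotational-∷ : ∀ {P g} → NearlyRotational P → NearlyRotational (g ∷ P)
  nearlyRotational-∷ (c , rotational-cP) = c , λ a → ∈⟨⟩-swap (∈⟨⟩-∷⁺ (rotational-cP a))

  first-reflection : ∀ {P g} → ¬ Reflective P → Reflective (g ∷ P) → ∃ λ c → g ≡ ref c
  first-reflection ¬refl-P (b , inj₁ ref-b∈P) = ⊥-elim (¬refl-P (b , ref-b∈P))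
  first-reflection ¬refl-P (b , inj₂ ref-b≡g) = b , sym ref-b≡g

  rotational-∷⁻ : ∀ {P g} → ¬ Reflective P → Reflective (g ∷ P) → Rotational (g ∷ P) → Rotational P
  rotational-∷⁻ ¬refl-P refl-gP rotational-gP a with first-reflection ¬refl-P refl-gP
  ... | c , refl = rot∈⟨ref∷⟩ ¬refl-P (rotational-gP a)

  nearlyRotational-∷⁻ : ∀ {P g} → ¬ Reflective P → Reflective (g ∷ P) → NearlyRotational (g ∷ P) → NearlyRotational P
  nearlyRotational-∷⁻ {P} ¬refl-P refl-gP (d , rotational-dgP) with first-reflection ¬refl-P refl-gP
  ... | c , refl = d , λ a → rot∈⟨ref∷⟩ ¬refl-dP (∈⟨⟩-swap (rotational-dgP a))
    where
    ¬refl-dP : ¬ Reflective (rot d ∷ P)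
    ¬refl-dP (b , inj₁ ref-b∈P) = ¬refl-P (b , ref-b∈P)

  reflective-∷-rotational : ∀ {P g} → Reflective P → Rotational (g ∷ P) → NearlyRotational P
  reflective-∷-rotational {g = c , false} _ rotational-gP = c , rotational-gP
  reflective-∷-rotational {P} {g = c , true} (b , ref-b∈P) rotational-gP =
    c ∙ b ⁻¹ , λ a → ⟨⟩-⊆ D ref-c∈ (rotational-gP a)
    where
    ref-c∈ : ∀ {x} → x ∈ ref c ∷ P → x ∈⟨ rot (c ∙ b ⁻¹) ∷ P ⟩
    ref-c∈ (inj₁ x∈P)  = gen (inj₁ x∈P)
    ref-c∈ (inj₂ refl) = subst (λ a → ref a ∈⟨ rot (c ∙ b ⁻¹) ∷ P ⟩) (//-rightDividesˡ b c)
                               (mul (gen (inj₂ refl)) (gen (inj₁ ref-b∈P)))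

  subgroup-reflective-even : ∀ {P} → Unique P → ¬ NewElement P → Reflective P → even (length P) ≡ true
  subgroup-reflective-even {P} P-unique ¬new (b , ref-b∈P) =
    even-length-if-fixedPointFree (_· ref b) ·ref-b-involutive P P-unique
      (λ x∈P → ¬newElement⇒closed ¬new (mul (gen x∈P) (gen ref-b∈P)))
      (λ { {a , false} _ () ; {a , true} _ () })
    where
    ·ref-b-involutive : ∀ x → (x · ref b) · ref b ≡ x
    ·ref-b-involutive (a , false) = cong rot (//-rightDividesʳ b a)
    ·ref-b-involutive (a , true)  = cong ref (//-rightDividesˡ b a)

  newElement-if-reflective-odd : ∀ {P} → Unique P → Reflective P → even (length P) ≡ false → NewElement P
  newElement-if-reflective-odd {P} P-unique refl-P odd-P with newElement? P
  ... | yes new = new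
  ... | no ¬new with trans (sym (subgroup-reflective-even P-unique ¬new refl-P)) odd-P
  ... | ()

  module _ (odd-order : Odd order) where

    subgroup-¬reflective-odd : ∀ {P} → Unique P → ¬ NewElement P → ¬ Reflective P → even (length P) ≡ false
    subgroup-¬reflective-odd {P} P-unique ¬new ¬refl-P =
      odd-length-if-uniqueFixedPoint _⁻¹ᴰ ⁻¹ᴰ-involutive P P-unique
        (λ x∈P → ¬newElement⇒closed ¬new (inv (gen x∈P)))
        (¬newElement⇒closed ¬new one) (cong rot ε⁻¹≈ε) only-ε-fixed
      where
      ⁻¹ᴰ-involutive : ∀ x → x ⁻¹ᴰ ⁻¹ᴰ ≡ x
      ⁻¹ᴰ-involutive (a , false) = cong rot (⁻¹-involutive a)
      ⁻¹ᴰ-involutive (a , true)  = cong ref (trans (⁻¹-involutive _) (⁻¹-involutive a))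
      only-ε-fixed : ∀ {x} → x ∈ P → x ⁻¹ᴰ ≡ x → x ≡ rot ε
      only-ε-fixed {a , false} _ a⁻¹≡a = cong rot (odd-order⇒x∙x≡ε⇒x≡ε odd-order a
        (trans (cong (a ∙_) (sym (cong proj₁ a⁻¹≡a))) (inverseʳ a)))
      only-ε-fixed {a , true} a∈P _ = ⊥-elim (¬refl-P (a , a∈P))

    newElement-if-¬reflective-even : ∀ {P} → Unique P → ¬ Reflective P → even (length P) ≡ true → NewElement P
    newElement-if-¬reflective-even {P} P-unique ¬refl-P even-P with newElement? P
    ... | yes new = new
    ... | no ¬new with trans (sym even-P) (subgroup-¬reflective-odd P-unique ¬new ¬refl-P)
    ... | ()

  rotational⇒nearlyRotational : ∀ {P} → Rotational P → NearlyRotational P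
  rotational⇒nearlyRotational rotational-P = ε , rotational-∷ rotational-P

  reflective-rot∷⁻ : ∀ {P c} → Reflective (rot c ∷ P) → Reflective P
  reflective-rot∷⁻ (b , inj₁ ref-b∈P) = b , ref-b∈P

  ¬nearlyRotational-[] : ¬ HasGenSetOfSize A 1 → ¬ NearlyRotational []
  ¬nearlyRotational-[] not-cyclic (c , rotational-c) =
    not-cyclic (c ∷ [] , λ a → ⟨⟩-⊆ sig c-generates (proj₂ (¬reflective-⟨⟩ ¬refl (rotational-c a))))
    where
    ¬refl : ¬ Reflective (rot c ∷ [])
    ¬refl (_ , inj₁ ())
    c-generates : ∀ {a} → rot a ∈ rot c ∷ [] → ⟨_⟩ sig (_∈ᵥ c ∷ []) a
    c-generates (inj₂ refl) = gen (here refl)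

  rotational-u-v : ∀ {u v} → Generates sig (_∈ᵥ u ∷ v ∷ []) → ∀ P → Rotational (rot v ∷ rot u ∷ P)
  rotational-u-v {u} {v} u,v-generate P a = rot-⟨⟩ generator∈ (u,v-generate a)
    where
    generator∈ : ∀ {c} → c ∈ᵥ u ∷ v ∷ [] → rot c ∈⟨ rot v ∷ rot u ∷ P ⟩
    generator∈ (here refl)         = gen (inj₁ (inj₂ refl))
    generator∈ (there (here refl)) = gen (inj₂ refl)

_⇒ᵇ_ : Bool → Bool → Bool
a ⇒ᵇ b = not a ∨ b

infixr 4 _⇒ᵇ_

modus-ponens : ∀ {a b} → T (a ⇒ᵇ b) → T a → T b
modus-ponens {true} b _ = b

BoolFun : ℕ → Set
BoolFun zero    = Bool
BoolFun (suc n) = Bool → BoolFun n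

Tautology : ∀ n → BoolFun n → Set
Tautology zero    b = T b
Tautology (suc n) f = ∀ b → Tautology n (f b)

tautology? : ∀ n → BoolFun n → Bool
tautology? zero    b = b
tautology? (suc n) f = tautology? n (f false) ∧ tautology? n (f true)

tautology?-sound : ∀ n f → T (tautology? n f) → Tautology n f
tautology?-sound zero    b t       = t
tautology?-sound (suc n) f t false = tautology?-sound n (f false) (proj₁ (Equivalence.to T-∧ t))
tautology?-sound (suc n) f t true  = tautology?-sound n (f true)  (proj₂ (Equivalence.to T-∧ t))

nimTable : (reflective rotational nearlyRotational even : Bool) → ℕ
nimTable true  true  _     _     = 0
nimTable true  false _     false = 2
nimTable true  false true  true  = 1
nimTable true  false false true  = 0
nimTable false true  _     true  = 2
nimTable false true  _     false = 1
nimTable false false _     true  = 3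
nimTable false false true  false = 0
nimTable false false false false = 1

validMove : (reflectiveP rotationalP nearlyP reflectiveQ rotationalQ nearlyQ : Bool) → Bool
validMove fP rP cP fQ rQ cQ =
  not (fP ∧ rP) ∧ (fP ⇒ᵇ fQ) ∧ (rP ⇒ᵇ rQ) ∧ (cP ⇒ᵇ cQ) ∧
  ((not fP ∧ fQ) ⇒ᵇ rQ ⇒ᵇ rP) ∧ ((not fP ∧ fQ) ⇒ᵇ cQ ⇒ᵇ cP) ∧ (fP ⇒ᵇ rQ ⇒ᵇ cP)

nimTable-moves : Tautology 7 λ fP rP cP e fQ rQ cQ →
  validMove fP rP cP fQ rQ cQ ⇒ᵇ (nimTable fQ rQ cQ (not e) ≡ᵇ nimTable fP rP cP e) ⇒ᵇ false
nimTable-moves = tautology?-sound 7 _ _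

nimTable-changes : ∀ fP rP cP e fQ rQ cQ → T (validMove fP rP cP fQ rQ cQ) →
                   nimTable fQ rQ cQ (not e) ≢ nimTable fP rP cP e
nimTable-changes fP rP cP e fQ rQ cQ valid same =
  modus-ponens (modus-ponens (nimTable-moves fP rP cP e fQ rQ cQ) valid) (≡⇒≡ᵇ _ _ same)

module NimValues (A : FinAbGroup) (odd-order : Odd (FinAbGroup.order A))
                 {u v : FinAbGroup.Carrier A} (u,v-generate : Generates (FinAbGroup.sig A) (_∈ᵥ u ∷ v ∷ []))
                 (not-cyclic : ¬ HasGenSetOfSize A 1) where

  open FiniteAbelianGroup A using (Carrier; ε)
  open Dihedral A
  open Enumerated _≟ᴰ_ elementsᴰ elementsᴰ-complete using (_⊏_; missing-∷; ⊏-wellFounded)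

  Position : Set
  Position = List (Carrier × Bool)

  generates? : ∀ P → Dec (Generates D (_∈ P))
  generates? P = map′ (λ (refl-P , rot-P) → generates refl-P rot-P)
                      (λ gen-P → generates⇒reflective gen-P , λ a → gen-P (rot a))
                      (reflective? P ×-dec rotational? P)

  nim : Position → ℕ
  nim P = nimTable (does (reflective? P)) (does (rotational? P)) (does (nearlyRotational? P)) (even (length P))

  nim-reflects : ∀ P {f r c} → Reflects (Reflective P) f → Reflects (Rotational P) r →
                 Reflects (NearlyRotational P) c → nim P ≡ nimTable f r c (even (length P))
  nim-reflects P rf rr rc
    rewrite det (proof (reflective? P)) rf | det (proof (rotational? P)) rr
          | det (proof (nearlyRotational? P)) rc = refl

  nim-changes : ∀ {P} g → ¬ Generates D (_∈ P) → nim (g ∷ P) ≢ nim P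
  nim-changes {P} g ¬gen-P = nimTable-changes _ _ _ (even (length P)) _ _ _ (Equivalence.from T-≡ (dec-true
    (       ¬? (reflective? P ×-dec rotational? P)
      ×-dec (reflective? P →-dec reflective? Q)
      ×-dec (rotational? P →-dec rotational? Q)
      ×-dec (nearlyRotational? P →-dec nearlyRotational? Q)
      ×-dec ((¬? (reflective? P) ×-dec reflective? Q) →-dec (rotational? Q →-dec rotational? P))
      ×-dec ((¬? (reflective? P) ×-dec reflective? Q) →-dec (nearlyRotational? Q →-dec nearlyRotational? P))
      ×-dec (reflective? P →-dec (rotational? Q →-dec nearlyRotational? P)))
    ( (λ (refl-P , rot-P) → ¬gen-P (generates refl-P rot-P))
    , reflective-∷ , rotational-∷ , nearlyRotational-∷
    , (λ (¬refl-P , refl-Q) → rotational-∷⁻ ¬refl-P refl-Q)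
    , (λ (¬refl-P , refl-Q) → nearlyRotational-∷⁻ ¬refl-P refl-Q)
    , reflective-∷-rotational )))
    where
    Q : Position
    Q = g ∷ P

  Option : Position → ℕ → Set
  Option P m = ∃ λ g → g ∉ P × nim (g ∷ P) ≡ m

  option : ∀ {P g f r c e} → g ∉ P → even (length P) ≡ e → Reflects (Reflective (g ∷ P)) f →
           Reflects (Rotational (g ∷ P)) r → Reflects (NearlyRotational (g ∷ P)) c → Option P (nimTable f r c (not e))
  option {P} {g} g∉P refl rf rr rc = g , g∉P , nim-reflects (g ∷ P) rf rr rc

  adjoin-new : ∀ {P f r c e} → even (length P) ≡ e → Reflects (Reflective P) f → Reflects (Rotational P) r →
               Reflects (NearlyRotational P) c → NewElement P → Option P (nimTable f r c (not e))
  adjoin-new {P} parity rf rr rc (h , h∈⟨P⟩ , h∉P) = option h∉P parity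
    (Reflects-map reflective-∷ reflective-h∷⁻ rf)
    (Reflects-map rotational-∷ (λ rot-hP a → ∈⟨⟩-∷⁻ h∈⟨P⟩ (rot-hP a)) rr)
    (Reflects-map nearlyRotational-∷ (λ (c , rot-chP) → c , λ a → ∈⟨⟩-∷⁻ (∈⟨⟩-∷⁺ h∈⟨P⟩) (∈⟨⟩-swap (rot-chP a))) rc)
    where
    reflective-h∷⁻ : Reflective (h ∷ P) → Reflective P
    reflective-h∷⁻ (b , inj₁ ref-b∈P) = b , ref-b∈P
    reflective-h∷⁻ (b , inj₂ ref-b≡h) with reflective? P
    ... | yes refl-P = refl-P
    ... | no ¬refl-P with ¬reflective-⟨⟩ ¬refl-P (subst (_∈⟨ P ⟩) (sym ref-b≡h) h∈⟨P⟩)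
    ... | () , _

  adjoin-rotation : ∀ {P f e} → even (length P) ≡ e → Reflects (Reflective P) f → ¬ Rotational P →
                    NearlyRotational P → Option P (nimTable f true true (not e))
  adjoin-rotation {P} parity rf ¬rot-P (c , rot-cP) = option c∉P parity
    (Reflects-map reflective-∷ reflective-rot∷⁻ rf) (ofʸ rot-cP) (ofʸ (rotational⇒nearlyRotational rot-cP))
    where
    c∉P : rot c ∉ P
    c∉P c∈P = ¬rot-P λ a → ∈⟨⟩-∷⁻ (gen c∈P) (rot-cP a)

  adjoin-u : ∀ {P f e} → even (length P) ≡ e → Reflects (Reflective P) f → ¬ NearlyRotational P →
             Option P (nimTable f false true (not e))
  adjoin-u {P} parity rf ¬near-P = option u∉P parity
    (Reflects-map reflective-∷ reflective-rot∷⁻ rf) (ofⁿ λ rot-uP → ¬near-P (u , rot-uP))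
    (ofʸ (v , rotational-u-v u,v-generate P))
    where
    u∉P : rot u ∉ P
    u∉P u∈P = ¬near-P (v , λ a → ∈⟨⟩-∷⁻ (gen (inj₁ u∈P)) (∈⟨⟩-swap (rotational-u-v u,v-generate P a)))

  adjoin-reflection : ∀ {P r c e} → even (length P) ≡ e → ¬ Reflective P → Reflects (Rotational P) r →
                      Reflects (NearlyRotational P) c → Option P (nimTable true r c (not e))
  adjoin-reflection {P} parity ¬refl-P rr rc = option (λ ref-ε∈P → ¬refl-P (ε , ref-ε∈P)) parity
    (ofʸ refl-εP)
    (Reflects-map rotational-∷ (rotational-∷⁻ ¬refl-P refl-εP) rr)
    (Reflects-map nearlyRotational-∷ (nearlyRotational-∷⁻ ¬refl-P refl-εP) rc)
    where
    refl-εP : Reflective (ref ε ∷ P)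
    refl-εP = ε , inj₂ refl

  module _ {P : Position} (P-unique : Unique P) (¬gen-P : ¬ Generates D (_∈ P)) where

    options-below : (f? : Dec (Reflective P)) (r? : Dec (Rotational P)) (c? : Dec (NearlyRotational P)) (e : Bool) →
                    even (length P) ≡ e → ∀ m → m < nimTable (does f?) (does r?) (does c?) e → Option P m
    options-below (yes refl-P) (yes rot-P) _ _ _ _ _ = ⊥-elim (¬gen-P (generates refl-P rot-P))
    options-below (yes refl-P) (no ¬rot-P) (yes near-P) e parity zero _ =
      adjoin-rotation parity (ofʸ refl-P) ¬rot-P near-P
    options-below (yes refl-P) (no ¬rot-P) (yes near-P) false parity (suc zero) _ =
      adjoin-new parity (ofʸ refl-P) (ofⁿ ¬rot-P) (ofʸ near-P) (newElement-if-reflective-odd P-unique refl-P parity)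
    options-below (yes refl-P) (no ¬rot-P) (no ¬near-P) false parity zero _ =
      adjoin-new parity (ofʸ refl-P) (ofⁿ ¬rot-P) (ofⁿ ¬near-P) (newElement-if-reflective-odd P-unique refl-P parity)
    options-below (yes refl-P) (no ¬rot-P) (no ¬near-P) false parity (suc zero) _ =
      adjoin-u parity (ofʸ refl-P) ¬near-P
    options-below (no ¬refl-P) (yes rot-P) c? e parity zero _ =
      adjoin-reflection parity ¬refl-P (ofʸ rot-P) (proof c?)
    options-below (no ¬refl-P) (yes rot-P) c? true parity (suc zero) _ =
      adjoin-new parity (ofⁿ ¬refl-P) (ofʸ rot-P) (proof c?) (newElement-if-¬reflective-even odd-order P-unique ¬refl-P parity)
    options-below (no ¬refl-P) (no ¬rot-P) (yes near-P) true parity zero _ =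
      adjoin-new parity (ofⁿ ¬refl-P) (ofⁿ ¬rot-P) (ofʸ near-P) (newElement-if-¬reflective-even odd-order P-unique ¬refl-P parity)
    options-below (no ¬refl-P) (no ¬rot-P) (yes near-P) true parity (suc zero) _ =
      adjoin-rotation parity (ofⁿ ¬refl-P) ¬rot-P near-P
    options-below (no ¬refl-P) (no ¬rot-P) (no ¬near-P) true parity zero _ =
      adjoin-u parity (ofⁿ ¬refl-P) ¬near-P
    options-below (no ¬refl-P) (no ¬rot-P) (no ¬near-P) true parity (suc zero) _ =
      adjoin-new parity (ofⁿ ¬refl-P) (ofⁿ ¬rot-P) (ofⁿ ¬near-P) (newElement-if-¬reflective-even odd-order P-unique ¬refl-P parity)
    options-below (no ¬refl-P) (no ¬rot-P) c? true parity (suc (suc zero)) _ =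
      adjoin-reflection parity ¬refl-P (ofⁿ ¬rot-P) (proof c?)
    options-below (no ¬refl-P) (no ¬rot-P) (no ¬near-P) false parity zero _ =
      adjoin-reflection parity ¬refl-P (ofⁿ ¬rot-P) (ofⁿ ¬near-P)
    options-below (yes _) (no _) _ false _ (suc (suc _)) (s≤s (s≤s ()))
    options-below (yes _) (no _) (yes _) true _ (suc _) (s≤s ())
    options-below (yes _) (no _) (no _) true _ _ ()
    options-below (no _) (yes _) _ false _ (suc _) (s≤s ())
    options-below (no _) (yes _) _ true _ (suc (suc _)) (s≤s (s≤s ()))
    options-below (no _) (no _) _ true _ (suc (suc (suc _))) (s≤s (s≤s (s≤s ())))
    options-below (no _) (no _) (yes _) false _ _ ()
    options-below (no _) (no _) (no _) false _ (suc _) (s≤s ())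

    nim-options-below : ∀ m → m < nim P → Option P m
    nim-options-below = options-below (reflective? P) (rotational? P) (nearlyRotational? P) (even (length P)) refl

  nim-generating : ∀ {P} → Generates D (_∈ P) → nim P ≡ 0
  nim-generating {P} gen-P = nim-reflects P (ofʸ (generates⇒reflective gen-P)) (ofʸ (λ a → gen-P (rot a)))
                                            (proof (nearlyRotational? P))

  nimValue : ∀ P → Unique P → Acc _⊏_ P → NimValue D (_∈ P) (nim P)
  nimValue P P-unique (acc smaller) with generates? P
  ... | yes gen-P = subst (NimValue D (_∈ P)) (sym (nim-generating gen-P)) (terminal gen-P)
  ... | no ¬gen-P = mex ¬gen-P
    (λ g g∉P → nim (g ∷ P) , optionValue g∉P , nim-changes g ¬gen-P)
    (λ m m<nim → let (g , g∉P , nim≡m) = nim-options-below P-unique ¬gen-P m m<nim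
                 in g , g∉P , subst (NimValue D (_∈ g ∷ P)) nim≡m (optionValue g∉P))
    where
    optionValue : ∀ {g} → g ∉ P → NimValue D (_∈ g ∷ P) (nim (g ∷ P))
    optionValue g∉P = nimValue _ (g∉P , P-unique) (smaller (missing-∷ g∉P))

  nim-[] : nim [] ≡ 3
  nim-[] = nim-reflects [] (ofⁿ λ { (_ , ()) }) (ofⁿ λ rot-[] → ¬near-[] (rotational⇒nearlyRotational rot-[]))
                           (ofⁿ ¬near-[])
    where
    ¬near-[] : ¬ NearlyRotational []
    ¬near-[] = ¬nearlyRotational-[] not-cyclic

  GEN≡*nim-[] : GEN≡* D (nim [])
  GEN≡*nim-[] = nimValue [] tt (⊏-wellFounded [])

proposition5p7 : (A : FinAbGroup) → Odd (FinAbGroup.order A) → d≡ A 2 → GEN≡* (Dih A) 3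
proposition5p7 A odd-order ((u ∷ v ∷ [] , u,v-generate) , minimal) = subst (GEN≡* (Dih A)) nim-[] GEN≡*nim-[]
  where
  open NimValues A odd-order u,v-generate (minimal 1 (s≤s (s≤s z≤n)))
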